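{- Let $k \ge 2$. A permutation $w$ satisfies $\mathcal{P}(w) = \mathcal{P}(12\cdots k)$ if and only if $w = 12\cdots k$ or $w = k\cdots 21$. In particular, exactly two permutations have this interval poset.
   Context: For $w \in \mathfrak{S}_n$ in one-line notation $w(1)\cdots w(n)$, an interval of $w$ is a set of consecutive integers $[h,h+j]$ with $\{w(t) : t \in [i,i+j]\} = [h,h+j]$ for some $i$. The interval poset $\mathcal{P}(w)$ is the set of nonempty intervals of $w$ ordered by inclusion. Thus $\mathcal{P}(12\cdots k)$ (called the argyle poset with $k$ minimal elements) consists of all sets $[i,j]$ with $1 \le i \le j \le k$, ordered by inclusion. -}

module Defs where

open import Data.Nat using (ℕ; _+_; _≤_; _<_)
open import Data.Fin using (Fin; toℕ)
open import Data.Fin.Permutation using (Permutation′; _⟨$⟩ʳ_)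
import Data.Fin.Permutation as Perm
open import Data.Product using (Σ; _×_; _,_)
open import Data.Refinement using (Refinement; value)
open import Function.Bundles using (_↔_; _⇔_; Inverse)
open import Relation.Binary.PropositionalEquality using (_≡_)

-- Conventions: a permutation w ∈ S_n is a bijection Fin n → Fin n; positions and
-- values are 0-indexed (position t ↦ t+1, value v ↦ v+1 recovers the paper's
-- 1-indexed one-line notation).  An integer range [h , h + j] is encoded by the
-- pair (h , j).

_∈[_,_] : ℕ → ℕ → ℕ → Set
x ∈[ h , j ] = h ≤ x × x ≤ h + j

_⊆_ : ℕ × ℕ → ℕ × ℕ → Set
(h , j) ⊆ (h' , j') = ∀ x → x ∈[ h , j ] → x ∈[ h' , j' ]

IsInterval : ∀ {n} → Permutation′ n → ℕ × ℕ → Set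
IsInterval {n} w (h , j) =
  (h + j < n) ×
  Σ ℕ λ i → (i + j < n) ×
    ((p : Fin n) → toℕ p ∈[ i , j ] → toℕ (w ⟨$⟩ʳ p) ∈[ h , j ]) ×
    ((v : Fin n) → toℕ v ∈[ h , j ] →
       Σ (Fin n) λ p → toℕ p ∈[ i , j ] × w ⟨$⟩ʳ p ≡ v)

-- Carrier of the interval poset P(w): the (nonempty) intervals of w.
-- (The witness is irrelevant, so an element is determined by its range.)
Intervals : ∀ {n} → Permutation′ n → Set
Intervals w = Refinement (ℕ × ℕ) (IsInterval w)

_≤P_ : ∀ {n} {w : Permutation′ n} → Intervals w → Intervals w → Set
x ≤P y = value x ⊆ value y

record _≅P_ {n m} (w : Permutation′ n) (w' : Permutation′ m) : Set where
  field
    bij   : Intervals w ↔ Intervals w'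
    order : ∀ x y → (value x ⊆ value y) ⇔
                    (value (Inverse.to bij x) ⊆ value (Inverse.to bij y))

idPerm : (k : ℕ) → Permutation′ k
idPerm k = Perm.id

-- An isomorphism of interval posets sends singletons to singletons, since these are the minimal
-- elements, and the singletons below an interval are exactly its points; so it preserves the
-- width of every interval, and the two permutations have equally many points. If
-- P(w) ≅ P(12⋯k), the k − 1 intervals of width one of 12⋯k are matched by as many intervals of
-- width one of w, so every pair {u, u + 1} is an interval of w: consecutive values sit at adjacent
-- positions. A position map of this kind cannot change direction without revisiting a position,
-- hence it is the identity or the reversal. Conversely every range is an interval of 12⋯k and of
-- k⋯21, so the identity on ranges is an isomorphism.
module Submission where

open import Defs
open import Data.Nat using (ℕ; zero; suc; _+_; _≤_; _<_; _∸_; s≤s; s≤s⁻¹; _<?_; _≟_)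
open import Data.Nat.Properties
open import Data.Fin using (Fin; zero; suc; toℕ; fromℕ<; opposite; punchOut)
open import Data.Fin.Properties
  using (toℕ-injective; toℕ-fromℕ<; fromℕ<-toℕ; fromℕ<-injective; toℕ<n; injective⇒≤;
         punchOut-injective; any?; opposite-prop; opposite-involutive)
  renaming (_≟_ to _≟ᶠ_)
open import Data.Fin.Permutation using (Permutation′; _⟨$⟩ʳ_; _⟨$⟩ˡ_; inverseˡ; inverseʳ)
open import Data.Irrelevant using (Irrelevant; [_])
import Data.Irrelevant as Irrelevant
open import Data.Refinement using (Refinement; _,_; value; proof; value-injective)
open import Data.Refinement.Base using (refine)
open import Data.Product using (∃; _×_; _,_; proj₁; proj₂)
open import Data.Sum using (_⊎_; inj₁; inj₂)
import Data.Sum as Sum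
open import Function.Base using (_∘_)
open import Function.Bundles using (_⇔_; Inverse; Equivalence; mk⇔; mk↔ₛ′)
open import Function.Definitions using (Injective)
open import Function.Properties.Inverse using (↔-sym)
open import Relation.Nullary using (Dec; yes; no; contradiction)
open import Relation.Nullary.Decidable using (recompute; _⊎-dec_)
open import Relation.Binary.PropositionalEquality

recompute-irrelevant : ∀ {A : Set} → Dec A → Irrelevant A → A
recompute-irrelevant a? [ a ] = recompute a? a

start∈ : ∀ h j → h ∈[ h , j ]
start∈ h j = ≤-refl , m≤m+n h j

∈[,0]⇒≡ : ∀ {x h} → x ∈[ h , 0 ] → x ≡ h
∈[,0]⇒≡ {x} {h} (h≤x , x≤h+0) = ≤-antisym (subst (x ≤_) (+-identityʳ h) x≤h+0) h≤x

∈[,1]⇒ : ∀ {x h} → x ∈[ h , 1 ] → x ≡ h ⊎ x ≡ suc h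
∈[,1]⇒ {x} {h} (h≤x , x≤h+1) with m≤n⇒m<n∨m≡n h≤x
... | inj₂ h≡x = inj₁ (sym h≡x)
... | inj₁ h<x = inj₂ (≤-antisym (subst (x ≤_) (+-comm h 1) x≤h+1) h<x)

point⊆ : ∀ {t h j} → t ∈[ h , j ] → (t , 0) ⊆ (h , j)
point⊆ t∈ x x∈ = subst (_∈[ _ , _ ]) (sym (∈[,0]⇒≡ x∈)) t∈

⊆-point⇒≡ : ∀ {a b h} → (a , b) ⊆ (h , 0) → (a , b) ≡ (h , 0)
⊆-point⇒≡ {a} {b} {h} ⊆h = cong₂ _,_ a≡h (+-cancelˡ-≡ a b 0 (trans (trans a+b≡h (sym a≡h)) (sym (+-identityʳ a))))
  where
  a≡h : a ≡ h
  a≡h = ∈[,0]⇒≡ (⊆h a (start∈ a b))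
  a+b≡h : a + b ≡ h
  a+b≡h = ∈[,0]⇒≡ (⊆h (a + b) (m≤m+n a b , ≤-refl))

Adjacent : ℕ → ℕ → Set
Adjacent a b = b ≡ suc a ⊎ a ≡ suc b

adjacent? : ∀ a b → Dec (Adjacent a b)
adjacent? a b = (b ≟ suc a) ⊎-dec (a ≟ suc b)

distinct-∈[,1]⇒adjacent : ∀ {x y h} → x ∈[ h , 1 ] → y ∈[ h , 1 ] → x ≢ y → Adjacent x y
distinct-∈[,1]⇒adjacent x∈ y∈ x≢y with ∈[,1]⇒ x∈ | ∈[,1]⇒ y∈
... | inj₁ refl | inj₁ refl = contradiction refl x≢y
... | inj₂ refl | inj₂ refl = contradiction refl x≢y
... | inj₁ refl | inj₂ refl = inj₁ refl
... | inj₂ refl | inj₁ refl = inj₂ refl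

injection⇒≤ : ∀ {a b} (f : ∀ t → t < a → ℕ) → (∀ t lt → f t lt < b) →
  (∀ {s t} ls lt → f s ls ≡ f t lt → s ≡ t) → a ≤ b
injection⇒≤ f f<b f-injective = injective⇒≤ {f = g} g-injective
  where
  g : Fin _ → Fin _
  g i = fromℕ< (f<b (toℕ i) (toℕ<n i))
  g-injective : Injective _≡_ _≡_ g
  g-injective e = toℕ-injective (f-injective _ _ (fromℕ<-injective _ _ _ _ e))

range-injection⇒≤ : ∀ {h j h′ j′} (f : ∀ t → t ∈[ h , j ] → ℕ) → (∀ t t∈ → f t t∈ ∈[ h′ , j′ ]) →
  (∀ {s t} s∈ t∈ → f s s∈ ≡ f t t∈ → s ≡ t) → j ≤ j′
range-injection⇒≤ {h} {j} {h′} {j′} f f∈ f-injective = s≤s⁻¹ (injection⇒≤ g g< g-injective)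
  where
  shift : ∀ {i} → i < suc j → (h + i) ∈[ h , j ]
  shift i<1+j = m≤m+n h _ , +-monoʳ-≤ h (s≤s⁻¹ i<1+j)
  g : ∀ i → i < suc j → ℕ
  g i lt = f (h + i) (shift lt) ∸ h′
  g< : ∀ i lt → g i lt < suc j′
  g< i lt = s≤s (subst (g i lt ≤_) (m+n∸m≡n h′ j′) (∸-monoˡ-≤ h′ (proj₂ (f∈ _ (shift lt)))))
  g-injective : ∀ {s t} ls lt → g s ls ≡ g t lt → s ≡ t
  g-injective ls lt e =
    +-cancelˡ-≡ h _ _ (f-injective _ _ (∸-cancelʳ-≡ (proj₁ (f∈ _ (shift ls))) (proj₁ (f∈ _ (shift lt))) e))

injective⇒surjective : ∀ {c} (φ : Fin c → Fin c) → Injective _≡_ _≡_ φ → ∀ v → ∃ λ i → φ i ≡ v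
injective⇒surjective {suc c} φ φ-injective v with any? (λ i → φ i ≟ᶠ v)
... | yes hit = hit
... | no miss = contradiction (injective⇒≤ ψ-injective) 1+n≰n
  where
  φ≢v : ∀ i → v ≢ φ i
  φ≢v i v≡φi = miss (i , sym v≡φi)
  ψ : Fin (suc c) → Fin c
  ψ i = punchOut (φ≢v i)
  ψ-injective : Injective _≡_ _≡_ ψ
  ψ-injective e = φ-injective (punchOut-injective (φ≢v _) (φ≢v _) e)

module _ {P : ℕ × ℕ → Set} where

  start width : Refinement (ℕ × ℕ) P → ℕ
  start x = proj₁ (value x)
  width x = proj₂ (value x)

  ⊆-width-zero⇒≡ : ∀ {y} x → width x ≡ 0 → value y ⊆ value x → y ≡ x
  ⊆-width-zero⇒≡ {y} x x₀ y⊆x =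
    value-injective (trans (⊆-point⇒≡ (subst (λ b → value y ⊆ (start x , b)) x₀ y⊆x))
                           (cong (start x ,_) (sym x₀)))

toℕ-opposite+suc : ∀ {m} (x : Fin m) → toℕ (opposite x) + suc (toℕ x) ≡ m
toℕ-opposite+suc x = trans (cong (_+ suc (toℕ x)) (opposite-prop x)) (m∸n+n≡m (toℕ<n x))

module _ {n} (w : Permutation′ n) where

  point-isInterval : ∀ {t} → t < n → IsInterval w (t , 0)
  point-isInterval {t} t<n = t+0<n , toℕ p , p+0<n , onto-point , point-onto
    where
    t+0<n : t + 0 < n
    t+0<n = subst (_< n) (sym (+-identityʳ t)) t<n
    p : Fin n
    p = w ⟨$⟩ˡ fromℕ< t<n
    p+0<n : toℕ p + 0 < n
    p+0<n = subst (_< n) (sym (+-identityʳ _)) (toℕ<n p)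
    w⟨p⟩≡t : toℕ (w ⟨$⟩ʳ p) ≡ t
    w⟨p⟩≡t = trans (cong toℕ (inverseʳ w)) (toℕ-fromℕ< t<n)
    onto-point : ∀ q → toℕ q ∈[ toℕ p , 0 ] → toℕ (w ⟨$⟩ʳ q) ∈[ t , 0 ]
    onto-point q q∈ rewrite toℕ-injective (∈[,0]⇒≡ q∈) | w⟨p⟩≡t = start∈ t 0
    point-onto : ∀ v → toℕ v ∈[ t , 0 ] → ∃ λ q → toℕ q ∈[ toℕ p , 0 ] × w ⟨$⟩ʳ q ≡ v
    point-onto v v∈ = p , start∈ _ 0 , toℕ-injective (trans w⟨p⟩≡t (sym (∈[,0]⇒≡ v∈)))

  identity-isInterval : (∀ p → w ⟨$⟩ʳ p ≡ p) → ∀ {h j} → h + j < n → IsInterval w (h , j)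
  identity-isInterval fixed {h} {j} h+j<n =
    h+j<n , h , h+j<n , (λ p p∈ → subst (λ v → toℕ v ∈[ h , j ]) (sym (fixed p)) p∈) , (λ v v∈ → v , v∈ , fixed v)

  reversal-isInterval : (∀ p → w ⟨$⟩ʳ p ≡ opposite p) → ∀ {h j} → h + j < n → IsInterval w (h , j)
  reversal-isInterval reversed {h} {j} h+j<n with r , refl ← m≤n⇒∃[o]m+o≡n h+j<n =
    h+j<n , r , r+j<n , reflect-onto , reflect-from
    where
    r+j<n : r + j < n
    r+j<n = s≤s (subst (_≤ h + j + r) (+-comm j r) (subst (j + r ≤_) (sym (+-assoc h j r)) (m≤n+m (j + r) h)))
    opposite+ : ∀ p → toℕ (opposite p) + toℕ p ≡ h + j + r
    opposite+ p = suc-injective (trans (sym (+-suc _ (toℕ p))) (toℕ-opposite+suc p))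
    reflect-∈ : ∀ {x y a b} → x + y ≡ a + j + b → y ∈[ b , j ] → x ∈[ a , j ]
    reflect-∈ {x} {y} {a} {b} e (b≤y , y≤b+j) =
      +-cancelʳ-≤ y a x (≤-trans (+-monoʳ-≤ a y≤b+j) (≤-reflexive (trans a+[b+j]≡ (sym e)))) ,
      +-cancelʳ-≤ y x (a + j) (≤-trans (≤-reflexive e) (+-monoʳ-≤ (a + j) b≤y))
      where
      a+[b+j]≡ : a + (b + j) ≡ a + j + b
      a+[b+j]≡ = trans (cong (a +_) (+-comm b j)) (sym (+-assoc a j b))
    reflect-onto : ∀ p → toℕ p ∈[ r , j ] → toℕ (w ⟨$⟩ʳ p) ∈[ h , j ]
    reflect-onto p p∈ rewrite reversed p = reflect-∈ (opposite+ p) p∈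
    reflect-from : ∀ v → toℕ v ∈[ h , j ] → ∃ λ p → toℕ p ∈[ r , j ] × w ⟨$⟩ʳ p ≡ v
    reflect-from v v∈ = opposite v ,
      reflect-∈ (trans (opposite+ v) (a+b+c≡c+b+a h j r)) v∈ , trans (reversed _) (opposite-involutive v)
      where
      a+b+c≡c+b+a : ∀ a b c → a + b + c ≡ c + b + a
      a+b+c≡c+b+a a b c = trans (+-comm (a + b) c) (trans (cong (c +_) (+-comm a b)) (sym (+-assoc c b a)))

  end<n : (x : Intervals w) → start x + width x < n
  end<n x = recompute-irrelevant (_ <? n) (Irrelevant.map proj₁ (proof x))

  point : ∀ t → t < n → Intervals w
  point t t<n = (t , 0) , [ point-isInterval t<n ]

≅P-sym : ∀ {n m} {w : Permutation′ n} {w′ : Permutation′ m} → w ≅P w′ → w′ ≅P w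
≅P-sym {w = w} {w′} iso = record { bij = ↔-sym bij ; order = λ x y → mk⇔ (from-mono x y) (from-reflects x y) }
  where
  open _≅P_ iso
  open Inverse bij using (to; from; strictlyInverseˡ)
  value-to-from : ∀ y → value (to (from y)) ≡ value y
  value-to-from y = cong value (strictlyInverseˡ y)
  from-mono : ∀ x y → value x ⊆ value y → value (from x) ⊆ value (from y)
  from-mono x y x⊆y =
    Equivalence.from (order (from x) (from y)) (subst₂ _⊆_ (sym (value-to-from x)) (sym (value-to-from y)) x⊆y)
  from-reflects : ∀ x y → value (from x) ⊆ value (from y) → value x ⊆ value y
  from-reflects x y fx⊆fy =
    subst₂ _⊆_ (value-to-from x) (value-to-from y) (Equivalence.to (order (from x) (from y)) fx⊆fy)

module _ {n m} {w : Permutation′ n} {w′ : Permutation′ m} (iso : w ≅P w′) where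
  open _≅P_ iso
  open Inverse bij using (to; from; strictlyInverseˡ; strictlyInverseʳ)

  to-injective : ∀ {x y} → to x ≡ to y → x ≡ y
  to-injective {x} {y} e = trans (sym (strictlyInverseʳ x)) (trans (cong from e) (strictlyInverseʳ y))

  to-width-zero : ∀ x → width x ≡ 0 → width (to x) ≡ 0
  to-width-zero x x₀ = cong width (sym p≡to-x)
    where
    p : Intervals w′
    p = point w′ (start (to x)) (≤-<-trans (m≤m+n _ _) (end<n w′ (to x)))
    from-p⊆x : value (from p) ⊆ value x
    from-p⊆x = Equivalence.from (order (from p) x)
      (subst (λ z → value z ⊆ value (to x)) (sym (strictlyInverseˡ p)) (point⊆ (start∈ _ _)))
    p≡to-x : p ≡ to x
    p≡to-x = trans (sym (strictlyInverseˡ p)) (cong to (⊆-width-zero⇒≡ x x₀ from-p⊆x))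

  image : ∀ t → t < n → ℕ
  image t t<n = start (to (point w t t<n))

  value-to-point : ∀ t t<n → value (to (point w t t<n)) ≡ (image t t<n , 0)
  value-to-point t t<n = cong (image t t<n ,_) (to-width-zero (point w t t<n) refl)

  image-injective : ∀ {s t} s<n t<n → image s s<n ≡ image t t<n → s ≡ t
  image-injective s<n t<n e = cong start (to-injective (value-injective
    (trans (value-to-point _ s<n) (trans (cong (_, 0) e) (sym (value-to-point _ t<n))))))

  image-∈ : ∀ x {t} t<n → t ∈[ start x , width x ] → image t t<n ∈[ start (to x) , width (to x) ]
  image-∈ x {t} t<n t∈ =
    subst (_⊆ value (to x)) (value-to-point t t<n)
      (Equivalence.to (order (point w t t<n) x) (point⊆ t∈)) (image t t<n) (start∈ _ 0)

  ≅P⇒≤ : n ≤ m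
  ≅P⇒≤ = injection⇒≤ image (λ t t<n → ≤-<-trans (m≤m+n _ _) (end<n w′ (to (point w t t<n)))) image-injective

  width≤width-to : ∀ x → width x ≤ width (to x)
  width≤width-to x = range-injection⇒≤ (λ t → image t ∘ in-range) (λ t t∈ → image-∈ x (in-range t∈) t∈)
    (λ s∈ t∈ → image-injective (in-range s∈) (in-range t∈))
    where
    in-range : ∀ {t} → t ∈[ start x , width x ] → t < n
    in-range t∈ = ≤-<-trans (proj₂ t∈) (end<n w x)

≅P⇒size≡ : ∀ {n m} {w : Permutation′ n} {w′ : Permutation′ m} → w ≅P w′ → n ≡ m
≅P⇒size≡ iso = ≤-antisym (≅P⇒≤ iso) (≅P⇒≤ (≅P-sym iso))

width-from : ∀ {n m} {w : Permutation′ n} {w′ : Permutation′ m} (iso : w ≅P w′) y →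
  width (Inverse.from (_≅P_.bij iso) y) ≡ width y
width-from iso y = ≤-antisym
  (subst (width (Inverse.from bij y) ≤_) (cong width (Inverse.strictlyInverseˡ bij y)) (width≤width-to iso _))
  (width≤width-to (≅P-sym iso) y)
  where open _≅P_ iso

-- Widths are preserved, so the n ∸ j width-j intervals of w′ inject into the width-j intervals of w,
-- of which there are at most n ∸ j; hence the injection is onto.
≅P-transfers-complete-width : ∀ {n} {w w′ : Permutation′ n} → w ≅P w′ → ∀ j →
  (∀ h → h + j < n → IsInterval w′ (h , j)) → ∀ h → h + j < n → Irrelevant (IsInterval w (h , j))
≅P-transfers-complete-width {n} {w} {w′} iso j complete h h+j<n =
  hit (injective⇒surjective φ φ-injective (fromℕ< h<n∸j))
  where
  open Inverse (_≅P_.bij iso) using (from)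
  h<n∸j : h < n ∸ j
  h<n∸j = m+n≤o⇒m≤o∸n (suc h) h+j<n
  range : Fin (n ∸ j) → Intervals w′
  range i = (toℕ i , j) , [ complete (toℕ i) (m≤o∸n⇒m+n≤o (suc (toℕ i)) (m+n≤o⇒n≤o (suc h) h+j<n) (toℕ<n i)) ]
  φ : Fin (n ∸ j) → Fin (n ∸ j)
  φ i = fromℕ< (m+n≤o⇒m≤o∸n (suc _)
          (subst (λ b → start (from (range i)) + b < n) (width-from iso (range i)) (end<n w (from (range i)))))
  φ-injective : Injective _≡_ _≡_ φ
  φ-injective {a} {b} e = toℕ-injective (cong start (to-injective (≅P-sym iso) (value-injective
    (cong₂ _,_ (fromℕ<-injective _ _ _ _ e) (trans (width-from iso (range a)) (sym (width-from iso (range b))))))))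
  hit : (∃ λ i → φ i ≡ fromℕ< h<n∸j) → Irrelevant (IsInterval w (h , j))
  hit (i , φi≡h) =
    subst (Irrelevant ∘ IsInterval w) (cong₂ _,_ start≡h (width-from iso (range i))) (proof (from (range i)))
    where
    start≡h : start (from (range i)) ≡ h
    start≡h = trans (sym (toℕ-fromℕ< _)) (trans (cong toℕ φi≡h) (toℕ-fromℕ< _))

PreservesAdjacency : ∀ {m} → (Fin m → Fin m) → Set
PreservesAdjacency π = ∀ x y → Adjacent (toℕ x) (toℕ y) → Adjacent (toℕ (π x)) (toℕ (π y))

opposite-reverses : ∀ {m} {x y : Fin m} → toℕ y ≡ suc (toℕ x) → toℕ (opposite x) ≡ suc (toℕ (opposite y))
opposite-reverses {x = x} {y} y≡1+x = +-cancelʳ-≡ (suc (toℕ x)) _ _ (begin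
  toℕ (opposite x) + suc (toℕ x)        ≡⟨ toℕ-opposite+suc x ⟩
  _                                     ≡⟨ toℕ-opposite+suc y ⟨
  toℕ (opposite y) + suc (toℕ y)        ≡⟨ cong (λ z → toℕ (opposite y) + suc z) y≡1+x ⟩
  toℕ (opposite y) + suc (suc (toℕ x))  ≡⟨ +-suc (toℕ (opposite y)) (suc (toℕ x)) ⟩
  suc (toℕ (opposite y)) + suc (toℕ x)  ∎)
  where open ≡-Reasoning

opposite-preservesAdjacency : ∀ {m} → PreservesAdjacency (opposite {m})
opposite-preservesAdjacency x y (inj₁ y≡1+x) = inj₂ (opposite-reverses y≡1+x)
opposite-preservesAdjacency x y (inj₂ x≡1+y) = inj₁ (opposite-reverses x≡1+y)

module Ascending {m} (π : Fin (2 + m) → Fin (2 + m)) (π-injective : Injective _≡_ _≡_ π)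
  (π-adjacent : PreservesAdjacency π) (π-ascends : toℕ (π (suc zero)) ≡ suc (toℕ (π zero))) where

  π̂ : (t : ℕ) → .(t < 2 + m) → ℕ
  π̂ t t<2+m = toℕ (π (fromℕ< t<2+m))

  π̂-injective : ∀ {s t} .(s<2+m : s < 2 + m) .(t<2+m : t < 2 + m) → π̂ s s<2+m ≡ π̂ t t<2+m → s ≡ t
  π̂-injective s<2+m t<2+m e = fromℕ<-injective _ _ s<2+m t<2+m (π-injective (toℕ-injective e))

  -- A descent right after an ascent would return to an already visited value.
  steps-up : ∀ t .(lt : suc t < 2 + m) → π̂ (suc t) lt ≡ suc (π̂ t (<-trans (n<1+n t) lt))
  steps-up zero lt = π-ascends
  steps-up (suc t) lt with π-adjacent (fromℕ< (<-trans (n<1+n (suc t)) lt)) (fromℕ< lt)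
    (inj₁ (trans (toℕ-fromℕ< lt) (cong suc (sym (toℕ-fromℕ< (<-trans (n<1+n (suc t)) lt))))))
  ... | inj₁ up = up
  ... | inj₂ down =
    contradiction (π̂-injective lt _ (suc-injective (trans (sym down) (steps-up t (<-trans (n<1+n (suc t)) lt)))))
                  (m≢1+n+m t ∘ sym)

  values : ∀ t .(lt : t < 2 + m) → π̂ t lt ≡ toℕ (π zero) + t
  values zero lt = sym (+-identityʳ _)
  values (suc t) lt = begin
    π̂ (suc t) lt              ≡⟨ steps-up t lt ⟩
    suc (π̂ t _)               ≡⟨ cong suc (values t (<-trans (n<1+n t) lt)) ⟩
    suc (toℕ (π zero) + t)    ≡⟨ +-suc (toℕ (π zero)) t ⟨
    toℕ (π zero) + suc t      ∎
    where open ≡-Reasoning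

  π-zero : toℕ (π zero) ≡ 0
  π-zero = n≤0⇒n≡0 (+-cancelʳ-≤ (suc m) _ 0 (s≤s⁻¹ (subst (_< 2 + m) (values (suc m) ≤-refl) (toℕ<n _))))

  ascending⇒id : ∀ x → π x ≡ x
  ascending⇒id x = toℕ-injective (begin
    toℕ (π x)                   ≡⟨ cong (toℕ ∘ π) (fromℕ<-toℕ x (toℕ<n x)) ⟨
    π̂ (toℕ x) (toℕ<n x)         ≡⟨ values (toℕ x) (toℕ<n x) ⟩
    toℕ (π zero) + toℕ x        ≡⟨ cong (_+ toℕ x) π-zero ⟩
    toℕ x                       ∎)
    where open ≡-Reasoning

-- Composing with the reversal turns a descending π into an ascending one.
preservesAdjacency⇒id⊎opposite : ∀ {m} (π : Fin m → Fin m) → Injective _≡_ _≡_ π → PreservesAdjacency π →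
  (∀ x → π x ≡ x) ⊎ (∀ x → π x ≡ opposite x)
preservesAdjacency⇒id⊎opposite {zero} π _ _ = inj₁ λ ()
preservesAdjacency⇒id⊎opposite {suc zero} π _ _ = inj₁ λ { zero → singleton (π zero) }
  where
  singleton : (x : Fin 1) → x ≡ zero
  singleton zero = refl
preservesAdjacency⇒id⊎opposite {suc (suc m)} π π-injective π-adjacent
  with π-adjacent zero (suc zero) (inj₁ refl)
... | inj₁ up = inj₁ (Ascending.ascending⇒id π π-injective π-adjacent up)
... | inj₂ down = inj₂ λ x → trans (sym (opposite-involutive (π x))) (cong opposite (opposite∘π≡id x))
  where
  opposite∘π≡id : ∀ x → opposite (π x) ≡ x
  opposite∘π≡id = Ascending.ascending⇒id (opposite ∘ π)
    (π-injective ∘ opposite-injective)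
    (λ x y → opposite-preservesAdjacency (π x) (π y) ∘ π-adjacent x y)
    (opposite-reverses down)
    where
    opposite-injective : Injective _≡_ _≡_ (opposite {suc (suc m)})
    opposite-injective {a} {b} e = trans (sym (opposite-involutive a)) (trans (cong opposite e) (opposite-involutive b))

pair-isInterval⇒adjacent-positions : ∀ {n} (w : Permutation′ n) {x y : Fin n} → IsInterval w (toℕ x , 1) →
  toℕ y ≡ suc (toℕ x) → Adjacent (toℕ (w ⟨$⟩ˡ x)) (toℕ (w ⟨$⟩ˡ y))
pair-isInterval⇒adjacent-positions w {x} {y} (_ , _ , _ , _ , onto) y≡1+x
  with p , p∈ , wp≡x ← onto x (start∈ _ 1)
     | q , q∈ , wq≡y ← onto y (subst (toℕ x ≤_) (sym y≡1+x) (n≤1+n _) , ≤-reflexive (trans y≡1+x (+-comm 1 (toℕ x))))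
  = subst₂ Adjacent (cong toℕ (position wp≡x)) (cong toℕ (position wq≡y)) (distinct-∈[,1]⇒adjacent p∈ q∈ p≢q)
  where
  position : ∀ {r v} → w ⟨$⟩ʳ r ≡ v → r ≡ w ⟨$⟩ˡ v
  position refl = sym (inverseˡ w)
  p≢q : toℕ p ≢ toℕ q
  p≢q p≡q = 1+n≢n (sym (trans (cong toℕ (trans (sym wp≡x) (trans (cong (w ⟨$⟩ʳ_) (toℕ-injective p≡q)) wq≡y))) y≡1+x))

idPerm-isInterval : ∀ {k h j} → h + j < k → IsInterval (idPerm k) (h , j)
idPerm-isInterval {k} = identity-isInterval (idPerm k) (λ _ → refl)

all-ranges⇒≅P-idPerm : ∀ {n} (w : Permutation′ n) → (∀ {h j} → h + j < n → IsInterval w (h , j)) → w ≅P idPerm n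
all-ranges⇒≅P-idPerm w complete = record
  { bij   = mk↔ₛ′ (refine (idPerm-isInterval ∘ proj₁)) (refine (complete ∘ proj₁)) (λ _ → refl) (λ _ → refl)
  ; order = λ _ _ → mk⇔ (λ x⊆y → x⊆y) (λ x⊆y → x⊆y)
  }

≅P-idPerm⇒id⊎reversal : ∀ {n} (w : Permutation′ n) → w ≅P idPerm n →
  (∀ p → w ⟨$⟩ʳ p ≡ p) ⊎ (∀ p → w ⟨$⟩ʳ p ≡ opposite p)
≅P-idPerm⇒id⊎reversal {n} w iso =
  Sum.map inverse-id inverse-opposite (preservesAdjacency⇒id⊎opposite (w ⟨$⟩ˡ_) ⟨$⟩ˡ-injective positions-adjacent)
  where
  pair-isInterval : ∀ h → h + 1 < n → Irrelevant (IsInterval w (h , 1))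
  pair-isInterval = ≅P-transfers-complete-width iso 1 (λ _ → idPerm-isInterval)
  consecutive : ∀ x y → toℕ y ≡ suc (toℕ x) → Adjacent (toℕ (w ⟨$⟩ˡ x)) (toℕ (w ⟨$⟩ˡ y))
  consecutive x y y≡1+x = recompute-irrelevant (adjacent? _ _)
    (Irrelevant.map (λ I → pair-isInterval⇒adjacent-positions w I y≡1+x)
      (pair-isInterval (toℕ x) (subst (_< n) (trans y≡1+x (+-comm 1 (toℕ x))) (toℕ<n y))))
  positions-adjacent : PreservesAdjacency (w ⟨$⟩ˡ_)
  positions-adjacent x y (inj₁ y≡1+x) = consecutive x y y≡1+x
  positions-adjacent x y (inj₂ x≡1+y) = Sum.swap (consecutive y x x≡1+y)
  ⟨$⟩ˡ-injective : Injective _≡_ _≡_ (w ⟨$⟩ˡ_)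
  ⟨$⟩ˡ-injective e = trans (sym (inverseʳ w)) (trans (cong (w ⟨$⟩ʳ_) e) (inverseʳ w))
  inverse-id : (∀ v → w ⟨$⟩ˡ v ≡ v) → ∀ p → w ⟨$⟩ʳ p ≡ p
  inverse-id fixed p = trans (sym (fixed _)) (inverseˡ w)
  inverse-opposite : (∀ v → w ⟨$⟩ˡ v ≡ opposite v) → ∀ p → w ⟨$⟩ʳ p ≡ opposite p
  inverse-opposite reversed p =
    trans (sym (opposite-involutive _)) (cong opposite (trans (sym (reversed _)) (inverseˡ w)))

≅P-idPerm⇒shape : ∀ {n k} (w : Permutation′ n) → w ≅P idPerm k →
  (n ≡ k) × ((∀ p → w ⟨$⟩ʳ p ≡ p) ⊎ (∀ p → w ⟨$⟩ʳ p ≡ opposite p))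
≅P-idPerm⇒shape {n} {k} w iso =
  n≡k , ≅P-idPerm⇒id⊎reversal w (subst (λ k → w ≅P idPerm k) (sym n≡k) iso)
  where
  n≡k : n ≡ k
  n≡k = ≅P⇒size≡ iso

shape⇒≅P-idPerm : ∀ {n k} (w : Permutation′ n) →
  (n ≡ k) × ((∀ p → w ⟨$⟩ʳ p ≡ p) ⊎ (∀ p → w ⟨$⟩ʳ p ≡ opposite p)) → w ≅P idPerm k
shape⇒≅P-idPerm w (refl , inj₁ fixed) = all-ranges⇒≅P-idPerm w (identity-isInterval w fixed)
shape⇒≅P-idPerm w (refl , inj₂ reversed) = all-ranges⇒≅P-idPerm w (reversal-isInterval w reversed)

proposition4p4 : (k : ℕ) → 2 ≤ k → (n : ℕ) (w : Permutation′ n) →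
    (w ≅P idPerm k) ⇔
      ((n ≡ k) × (((p : Fin n) → w ⟨$⟩ʳ p ≡ p) ⊎ ((p : Fin n) → w ⟨$⟩ʳ p ≡ opposite p)))
proposition4p4 k _ n w = mk⇔ (≅P-idPerm⇒shape w) (shape⇒≅P-idPerm w)
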